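{- Let $v\in\mathbb{N}$ and let $a_1,\dots,a_m$ be pairwise coprime divisors of $v$. (i) There exists a non-disjoint $\big(v,m,\frac{v}{a_1},\dots,\frac{v}{a_m}\big)$-GPSEDF in $\mathbb{Z}_v$. (ii) Let $\mu_1,\dots,\mu_m$ be integers with $0\le\mu_i\le a_i-1$ for $1\le i\le m$. Then there exists a non-disjoint $\big(v,m,\mu_1\frac{v}{a_1},\dots,\mu_m\frac{v}{a_m}\big)$-GPSEDF in $\mathbb{Z}_v$.
   Context: For subsets $A,B$ of an additively written group $G$, $\Delta(A,B)$ denotes the multiset $\{a-b:a\in A,b\in B\}$ (one entry per pair). For $\lambda\in\mathbb{N}\cup\{0\}$, $\lambda G$ is the multiset containing every element of $G$ exactly $\lambda$ times. Let $|G|=v$. A family of sets $\{A_1,\dots,A_m\}$ in $G$ with $|A_i|=k_i$ is a non-disjoint $(v,m,k_1,\dots,k_m)$-GPSEDF if $\Delta(A_i,A_j)=\lambda_{i,j}G$ with $\lambda_{i,j}=k_ik_j/v$ for all $1\le i\ne j\le m$. -}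

module Defs where

open import Data.Nat using (ℕ; _+_; _*_; _∸_; NonZero)
open import Data.Nat.DivMod using (_mod_)
open import Data.Fin using (Fin; toℕ)
open import Data.Fin.Subset using (Subset; _∈_; ∣_∣)
open import Data.Fin.Subset.Properties using (_∈?_)
open import Data.List using (List; length; filter; allFin; cartesianProduct)
open import Data.Product using (_×_; _,_; proj₁; proj₂)
open import Relation.Binary.PropositionalEquality using (_≡_; _≢_)
open import Relation.Nullary using (Dec)
open import Relation.Nullary.Decidable using (_×-dec_)
open import Data.Fin.Properties using (_≟_)

_⊖_ : ∀ {v} .{{_ : NonZero v}} → Fin v → Fin v → Fin v
_⊖_ {v} a b = (toℕ a + (v ∸ toℕ b)) mod v

-- multiplicity of g in the multiset Δ(A,B) = {a - b : a ∈ A, b ∈ B}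
-- (one entry per pair (a , b))
Δcount : ∀ {v} .{{_ : NonZero v}} → Subset v → Subset v → Fin v → ℕ
Δcount {v} A B g =
  length (filter (λ p → (proj₁ p ∈? A) ×-dec ((proj₂ p ∈? B) ×-dec ((proj₁ p ⊖ proj₂ p) ≟ g)))
                 (cartesianProduct (allFin v) (allFin v)))

-- {A_1..A_m} in ℤ_v with |A_i| = k_i is a non-disjoint (v,m,k_1,...,k_m)-GPSEDF:
-- for all i ≠ j, Δ(A_i,A_j) = λ_{ij} ℤ_v with λ_{ij} = k_i k_j / v, i.e. every
-- element g of ℤ_v occurs exactly λ_{ij} times, where λ_{ij} * v = k_i * k_j.
IsGPSEDF : ∀ (v m : ℕ) .{{_ : NonZero v}} → (k : Fin m → ℕ) → (A : Fin m → Subset v) → Set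
IsGPSEDF v m k A =
  (∀ i → ∣ A i ∣ ≡ k i) ×
  (∀ i j → i ≢ j → ∀ (g : Fin v) → Δcount (A i) (A j) g * v ≡ k i * k j)

{-# OPTIONS --safe #-}
-- Take A_i = {x ∈ ℤ_v : x mod a_i < μ_i}, a set of μ_i v / a_i elements (part (i) is μ_i = 1).
-- The multiplicity of g in Δ(A_i, A_j) is the correlation N(g) = Σ_y 1_{A_i}(g + y) 1_{A_j}(y).
-- N is invariant under g ↦ g + a_i because A_i is, and under g ↦ g + a_j because A_j is and
-- y ↦ y + a_j permutes ℤ_v. By Bézout, gcd(a_i, a_j) = 1 then makes N invariant under g ↦ g + 1,
-- so N is constant, and summing over g gives v N = |A_i| |A_j| = k_i k_j.
module Submission where

open import Defs
open import Data.Nat using (ℕ; _*_; _<_; NonZero)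
open import Data.Nat.Divisibility using (_∣_)
open import Data.Nat.Coprimality using (Coprime)
open import Data.Fin using (Fin)
open import Data.Fin.Subset using (Subset)
open import Data.Product using (Σ; _×_)
open import Relation.Binary.PropositionalEquality using (_≡_; _≢_)

open import Data.Bool.Base using (true; false; if_then_else_)
open import Data.Nat.Base using (zero; suc; _+_; _∸_; _≤_; s≤s; ≢-nonZero⁻¹; >-nonZero⁻¹)
open import Data.Nat.Properties
  using (_<?_; +-*-semiring; +-commutativeSemigroup; +-assoc; +-comm; +-identityʳ; +-cancelˡ-≡;
         *-assoc; *-comm; *-identityˡ; *-identityʳ; *-zeroʳ; *-cancelʳ-≡; <⇒≤; m+[n∸m]≡n; m∸n+n≡m)
open import Data.Nat.DivMod
  using (_%_; _/_; _mod_; m≡m%n+[m/n]*n; %-distribˡ-+; m%n%n≡m%n; [m+n]%n≡m%n; m<n⇒m%n≡m)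
open import Data.Nat.Divisibility using (divides; 0∣⇒≡0)
open import Data.Nat.Coprimality using (coprime⇒GCD≡1)
open import Data.Nat.GCD using (module Bézout)
open import Algebra.Properties.CommutativeSemigroup +-commutativeSemigroup using (x∙yz≈y∙xz; xy∙z≈y∙xz)
open import Algebra.Properties.Semiring.Sum +-*-semiring
  using (sum-syntax; sum-cong-≗; ∑-comm; *-distribˡ-sum; *-distribʳ-sum; sum-replicate-zero)
open import Data.Fin.Base using (zero; suc; toℕ)
open import Data.Fin.Properties using (toℕ<n; toℕ-injective; toℕ-fromℕ<; _≟_)
open import Data.Fin.Subset using (inside; outside; ∣_∣)
open import Data.Fin.Subset.Properties using (_∈?_)
open import Data.List.Base using (_++_; length; filter; tabulate; cartesianProduct; map)
open import Data.List.Properties using (filter-++; length-++; map-tabulate)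
import Data.Vec.Base as Vec
open import Data.Product.Base using (_,_; proj₁; proj₂)
open import Function.Bundles using (_⇔_; mk⇔)
open import Relation.Binary.PropositionalEquality using (refl; sym; trans; cong; cong₂; module ≡-Reasoning)
open import Relation.Nullary.Decidable using (Dec; yes; no; does; _×-dec_; does-⇔)
open import Relation.Nullary.Negation using (contradiction)
open import Relation.Unary using (Pred; Decidable)

𝟙 : ∀ {p} {P : Set p} → Dec P → ℕ
𝟙 P? = if does P? then 1 else 0

𝟙-×-dec : ∀ {p q} {P : Set p} {Q : Set q} (P? : Dec P) (Q? : Dec Q) → 𝟙 (P? ×-dec Q?) ≡ 𝟙 P? * 𝟙 Q?
𝟙-×-dec (yes _) (yes _) = refl
𝟙-×-dec (yes _) (no _)  = refl
𝟙-×-dec (no _)  _       = refl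

𝟙-⇔ : ∀ {p q} {P : Set p} {Q : Set q} → P ⇔ Q → (P? : Dec P) (Q? : Dec Q) → 𝟙 P? ≡ 𝟙 Q?
𝟙-⇔ P⇔Q P? Q? = cong (λ b → if b then 1 else 0) (does-⇔ P⇔Q P? Q?)

Periodic : ℕ → (ℕ → ℕ) → Set
Periodic p f = ∀ x → f (p + x) ≡ f x

∑ℕ : ℕ → (ℕ → ℕ) → ℕ
∑ℕ n f = ∑[ i < n ] f (toℕ i)

∑ℕ-cong : ∀ n {f g : ℕ → ℕ} → (∀ x → x < n → f x ≡ g x) → ∑ℕ n f ≡ ∑ℕ n g
∑ℕ-cong n f≡g = sum-cong-≗ (λ i → f≡g (toℕ i) (toℕ<n i))

∑ℕ-+ : ∀ m n (f : ℕ → ℕ) → ∑ℕ (m + n) f ≡ ∑ℕ m f + ∑ℕ n (λ x → f (m + x))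
∑ℕ-+ zero    n f = refl
∑ℕ-+ (suc m) n f = trans (cong (f 0 +_) (∑ℕ-+ m n (λ x → f (suc x)))) (sym (+-assoc (f 0) _ _))

∑ℕ-const : ∀ n c → ∑ℕ n (λ _ → c) ≡ n * c
∑ℕ-const zero    c = refl
∑ℕ-const (suc n) c = cong (c +_) (∑ℕ-const n c)

∑ℕ-< : ∀ {n μ} → μ ≤ n → ∑ℕ n (λ x → 𝟙 (x <? μ)) ≡ μ
∑ℕ-< {n}     {zero}  _         = sum-replicate-zero n
∑ℕ-< {suc n} {suc μ} (s≤s μ≤n) = cong suc (∑ℕ-< μ≤n)

∑ℕ-periodic : ∀ t p {f : ℕ → ℕ} → Periodic p f → ∑ℕ (t * p) f ≡ t * ∑ℕ p f
∑ℕ-periodic zero    p per = refl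
∑ℕ-periodic (suc t) p {f} per = begin
  ∑ℕ (p + t * p) f                        ≡⟨ ∑ℕ-+ p (t * p) f ⟩
  ∑ℕ p f + ∑ℕ (t * p) (λ x → f (p + x))   ≡⟨ cong (∑ℕ p f +_) (∑ℕ-cong (t * p) (λ x _ → per x)) ⟩
  ∑ℕ p f + ∑ℕ (t * p) f                   ≡⟨ cong (∑ℕ p f +_) (∑ℕ-periodic t p per) ⟩
  ∑ℕ p f + t * ∑ℕ p f                     ∎
  where open ≡-Reasoning

-- ∑ℕ (s + n) f is both (its first s terms) + lhs and, by periodicity, rhs + (its first s terms).
∑ℕ-rotate : ∀ n s {f : ℕ → ℕ} → Periodic n f → ∑ℕ n (λ x → f (s + x)) ≡ ∑ℕ n f
∑ℕ-rotate n s {f} per = +-cancelˡ-≡ (∑ℕ s f) _ _ (begin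
  ∑ℕ s f + ∑ℕ n (λ x → f (s + x))  ≡⟨ ∑ℕ-+ s n f ⟨
  ∑ℕ (s + n) f                      ≡⟨ cong (λ m → ∑ℕ m f) (+-comm s n) ⟩
  ∑ℕ (n + s) f                      ≡⟨ ∑ℕ-+ n s f ⟩
  ∑ℕ n f + ∑ℕ s (λ x → f (n + x))  ≡⟨ cong (∑ℕ n f +_) (∑ℕ-cong s (λ x _ → per x)) ⟩
  ∑ℕ n f + ∑ℕ s f                   ≡⟨ +-comm (∑ℕ n f) (∑ℕ s f) ⟩
  ∑ℕ s f + ∑ℕ n f                   ∎)
  where open ≡-Reasoning

periodic-* : ∀ {p f} → Periodic p f → ∀ n → Periodic (n * p) f
periodic-* per zero    x = refl
periodic-* {p} {f} per (suc n) x = begin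
  f (p + n * p + x)   ≡⟨ cong f (+-assoc p (n * p) x) ⟩
  f (p + (n * p + x)) ≡⟨ per (n * p + x) ⟩
  f (n * p + x)       ≡⟨ periodic-* per n x ⟩
  f x                 ∎
  where open ≡-Reasoning

periodic-∣ : ∀ {p q f} → Periodic p f → p ∣ q → Periodic q f
periodic-∣ per (divides n refl) = periodic-* per n

periodic-% : ∀ {p f} .{{_ : NonZero p}} → Periodic p f → ∀ x → f (x % p) ≡ f x
periodic-% {p} {f} per x = begin
  f (x % p)                 ≡⟨ periodic-* per (x / p) (x % p) ⟨
  f (x / p * p + x % p)     ≡⟨ cong f (+-comm (x / p * p) (x % p)) ⟩
  f (x % p + x / p * p)     ≡⟨ cong f (m≡m%n+[m/n]*n x p) ⟨
  f x                       ∎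
  where open ≡-Reasoning

periodic-1 : ∀ {p q f} m n → Periodic p f → Periodic q f → 1 + m * p ≡ n * q → Periodic 1 f
periodic-1 {p} {q} {f} m n perp perq eq x = begin
  f (1 + x)             ≡⟨ periodic-* perp m (1 + x) ⟨
  f (m * p + (1 + x))   ≡⟨ cong f (x∙yz≈y∙xz (m * p) 1 x) ⟩
  f (1 + m * p + x)     ≡⟨ cong (λ y → f (y + x)) eq ⟩
  f (n * q + x)         ≡⟨ periodic-* perq n x ⟩
  f x                   ∎
  where open ≡-Reasoning

periodic-1⇒constant : ∀ {f} → Periodic 1 f → ∀ x → f x ≡ f 0
periodic-1⇒constant per zero    = refl
periodic-1⇒constant per (suc x) = trans (per x) (periodic-1⇒constant per x)

coprime-periods⇒constant : ∀ {a b f} → Coprime a b → Periodic a f → Periodic b f → ∀ x → f x ≡ f 0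
coprime-periods⇒constant coprime pera perb with Bézout.identity (coprime⇒GCD≡1 coprime)
... | Bézout.+- m n eq = periodic-1⇒constant (periodic-1 n m perb pera eq)
... | Bézout.-+ m n eq = periodic-1⇒constant (periodic-1 m n pera perb eq)

correlation : ℕ → (ℕ → ℕ) → (ℕ → ℕ) → ℕ → ℕ
correlation n f h g = ∑ℕ n (λ y → f (g + y) * h y)

correlation-periodicˡ : ∀ n {p f h} → Periodic p f → Periodic p (correlation n f h)
correlation-periodicˡ n {p} {f} {h} per g =
  ∑ℕ-cong n (λ y _ → cong (_* h y) (trans (cong f (+-assoc p g y)) (per (g + y))))

correlation-periodicʳ : ∀ {n p f h} → Periodic n f → Periodic n h → Periodic p h →
                        Periodic p (correlation n f h)
correlation-periodicʳ {n} {p} {f} {h} pernf pernh perph g = begin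
  ∑ℕ n (λ y → f (p + g + y) * h y)           ≡⟨ ∑ℕ-cong n (λ y _ → cong₂ _*_ (cong f (xy∙z≈y∙xz p g y)) (sym (perph y))) ⟩
  ∑ℕ n (λ y → f (g + (p + y)) * h (p + y))   ≡⟨ ∑ℕ-rotate n p pern ⟩
  ∑ℕ n (λ y → f (g + y) * h y)               ∎
  where
  open ≡-Reasoning
  pern : Periodic n (λ y → f (g + y) * h y)
  pern y = cong₂ _*_ (trans (cong f (x∙yz≈y∙xz g n y)) (pernf (g + y))) (pernh y)

∑ℕ-correlation : ∀ n {f} h → Periodic n f → ∑ℕ n (correlation n f h) ≡ ∑ℕ n f * ∑ℕ n h
∑ℕ-correlation n {f} h per = begin
  ∑[ i < n ] ∑[ j < n ] (f (toℕ i + toℕ j) * h (toℕ j))   ≡⟨ ∑-comm {n} {n} (λ i j → f (toℕ i + toℕ j) * h (toℕ j)) ⟩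
  ∑[ j < n ] ∑[ i < n ] (f (toℕ i + toℕ j) * h (toℕ j))   ≡⟨ sum-cong-≗ {n} pull ⟨
  ∑[ j < n ] (∑ℕ n (λ x → f (x + toℕ j)) * h (toℕ j))   ≡⟨ sum-cong-≗ {n} (λ j → cong (_* h (toℕ j)) (shift j)) ⟩
  ∑[ j < n ] (∑ℕ n f * h (toℕ j))                        ≡⟨ *-distribˡ-sum {n} (∑ℕ n f) (λ j → h (toℕ j)) ⟨
  ∑ℕ n f * ∑ℕ n h                                        ∎
  where
  open ≡-Reasoning
  pull : ∀ j → ∑ℕ n (λ x → f (x + toℕ j)) * h (toℕ j) ≡ ∑[ i < n ] (f (toℕ i + toℕ j) * h (toℕ j))
  pull j = *-distribʳ-sum {n} (h (toℕ j)) (λ i → f (toℕ i + toℕ j))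
  shift : ∀ j → ∑ℕ n (λ x → f (x + toℕ j)) ≡ ∑ℕ n f
  shift j = trans (∑ℕ-cong n {g = λ x → f (toℕ j + x)} (λ x _ → cong f (+-comm x (toℕ j)))) (∑ℕ-rotate n (toℕ j) per)

correlation*n≡∑*∑ : ∀ {n a b f h} → Coprime a b → a ∣ n → b ∣ n → Periodic a f → Periodic b h →
                    ∀ g → correlation n f h g * n ≡ ∑ℕ n f * ∑ℕ n h
correlation*n≡∑*∑ {n} {a} {b} {f} {h} coprime a∣n b∣n perf perh g = begin
  N g * n          ≡⟨ cong (_* n) (constant g) ⟩
  N 0 * n          ≡⟨ *-comm (N 0) n ⟩
  n * N 0          ≡⟨ ∑ℕ-const n (N 0) ⟨
  ∑ℕ n (λ _ → N 0) ≡⟨ ∑ℕ-cong n (λ x _ → sym (constant x)) ⟩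
  ∑ℕ n N           ≡⟨ ∑ℕ-correlation n h (periodic-∣ perf a∣n) ⟩
  ∑ℕ n f * ∑ℕ n h  ∎
  where
  open ≡-Reasoning
  N = correlation n f h
  constant : ∀ x → N x ≡ N 0
  constant = coprime-periods⇒constant coprime (correlation-periodicˡ n {h = h} perf)
    (correlation-periodicʳ (periodic-∣ perf a∣n) (periodic-∣ perh b∣n) perh)

[m%d+n]%d≡[m+n]%d : ∀ m n d .{{_ : NonZero d}} → (m % d + n) % d ≡ (m + n) % d
[m%d+n]%d≡[m+n]%d m n d = begin
  (m % d + n) % d             ≡⟨ %-distribˡ-+ (m % d) n d ⟩
  (m % d % d + n % d) % d     ≡⟨ cong (λ r → (r + n % d) % d) (m%n%n≡m%n m d) ⟩
  (m % d + n % d) % d         ≡⟨ %-distribˡ-+ m n d ⟨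
  (m + n) % d                 ∎
  where open ≡-Reasoning

m<n⇒[m+n]%n≡m : ∀ {m n} .{{_ : NonZero n}} → m < n → (m + n) % n ≡ m
m<n⇒[m+n]%n≡m {m} {n} m<n = trans ([m+n]%n≡m%n m n) (m<n⇒m%n≡m m<n)

_⊕_ : ∀ {v} .{{_ : NonZero v}} → Fin v → Fin v → Fin v
_⊕_ {v} x y = (toℕ x + toℕ y) mod v

⊕-⊖-cancel : ∀ {v} .{{_ : NonZero v}} (x y : Fin v) → (x ⊕ y) ⊖ y ≡ x
⊕-⊖-cancel {v} x y = toℕ-injective (begin
  toℕ ((x ⊕ y) ⊖ y)             ≡⟨ toℕ-fromℕ< _ ⟩
  (toℕ (x ⊕ y) + (v ∸ Y)) % v   ≡⟨ cong (λ r → (r + (v ∸ Y)) % v) (toℕ-fromℕ< _) ⟩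
  ((X + Y) % v + (v ∸ Y)) % v   ≡⟨ [m%d+n]%d≡[m+n]%d (X + Y) (v ∸ Y) v ⟩
  (X + Y + (v ∸ Y)) % v         ≡⟨ cong (_% v) (trans (+-assoc X Y (v ∸ Y)) (cong (X +_) (m+[n∸m]≡n (<⇒≤ (toℕ<n y))))) ⟩
  (X + v) % v                   ≡⟨ m<n⇒[m+n]%n≡m (toℕ<n x) ⟩
  X                             ∎)
  where
  open ≡-Reasoning
  X = toℕ x
  Y = toℕ y

⊖-⊕-cancel : ∀ {v} .{{_ : NonZero v}} (x y : Fin v) → (x ⊖ y) ⊕ y ≡ x
⊖-⊕-cancel {v} x y = toℕ-injective (begin
  toℕ ((x ⊖ y) ⊕ y)             ≡⟨ toℕ-fromℕ< _ ⟩
  (toℕ (x ⊖ y) + Y) % v         ≡⟨ cong (λ r → (r + Y) % v) (toℕ-fromℕ< _) ⟩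
  ((X + (v ∸ Y)) % v + Y) % v   ≡⟨ [m%d+n]%d≡[m+n]%d (X + (v ∸ Y)) Y v ⟩
  (X + (v ∸ Y) + Y) % v         ≡⟨ cong (_% v) (trans (+-assoc X (v ∸ Y) Y) (cong (X +_) (m∸n+n≡m (<⇒≤ (toℕ<n y))))) ⟩
  (X + v) % v                   ≡⟨ m<n⇒[m+n]%n≡m (toℕ<n x) ⟩
  X                             ∎)
  where
  open ≡-Reasoning
  X = toℕ x
  Y = toℕ y

⊖≡⇔≡⊕ : ∀ {v} .{{_ : NonZero v}} {x y g : Fin v} → (x ⊖ y ≡ g) ⇔ (x ≡ g ⊕ y)
⊖≡⇔≡⊕ {x = x} {y} = mk⇔ (λ { refl → sym (⊖-⊕-cancel x y) }) (λ { refl → ⊕-⊖-cancel _ y })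

∣p∣≡∑𝟙∈ : ∀ {n} (p : Subset n) → ∣ p ∣ ≡ ∑[ i < n ] 𝟙 (i ∈? p)
∣p∣≡∑𝟙∈ Vec.[]            = refl
∣p∣≡∑𝟙∈ (inside Vec.∷ p)  = cong suc (∣p∣≡∑𝟙∈ p)
∣p∣≡∑𝟙∈ (outside Vec.∷ p) = ∣p∣≡∑𝟙∈ p

length-filter-tabulate : ∀ {a p} {A : Set a} {P : Pred A p} (P? : Decidable P) {n} (f : Fin n → A) →
                         length (filter P? (tabulate f)) ≡ ∑[ i < n ] 𝟙 (P? (f i))
length-filter-tabulate P? {zero}  f = refl
length-filter-tabulate P? {suc n} f with does (P? (f zero))
... | true  = cong suc (length-filter-tabulate P? (λ i → f (suc i)))
... | false = length-filter-tabulate P? (λ i → f (suc i))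

length-filter-cartesianProduct :
  ∀ {a b p} {A : Set a} {B : Set b} {P : Pred (A × B) p} (P? : Decidable P) {m n} (f : Fin m → A) (g : Fin n → B) →
  length (filter P? (cartesianProduct (tabulate f) (tabulate g))) ≡ ∑[ i < m ] ∑[ j < n ] 𝟙 (P? (f i , g j))
length-filter-cartesianProduct P? {zero}      f g = refl
length-filter-cartesianProduct P? {suc m} {n} f g = begin
  length (filter P? (map (f zero ,_) (tabulate g) ++ rest))
    ≡⟨ cong length (filter-++ P? (map (f zero ,_) (tabulate g)) rest) ⟩
  length (filter P? (map (f zero ,_) (tabulate g)) ++ filter P? rest)
    ≡⟨ length-++ (filter P? (map (f zero ,_) (tabulate g))) ⟩
  length (filter P? (map (f zero ,_) (tabulate g))) + length (filter P? rest)
    ≡⟨ cong₂ _+_ first (length-filter-cartesianProduct P? (λ i → f (suc i)) g) ⟩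
  ∑[ j < n ] 𝟙 (P? (f zero , g j)) + ∑[ i < m ] ∑[ j < n ] 𝟙 (P? (f (suc i) , g j))
    ∎
  where
  open ≡-Reasoning
  rest = cartesianProduct (tabulate (λ i → f (suc i))) (tabulate g)
  first : length (filter P? (map (f zero ,_) (tabulate g))) ≡ ∑[ j < n ] 𝟙 (P? (f zero , g j))
  first = trans (cong (λ xs → length (filter P? xs)) (map-tabulate g (f zero ,_)))
                (length-filter-tabulate P? (λ j → f zero , g j))

∑-𝟙≟ : ∀ {n} (f : Fin n → ℕ) (c : Fin n) → ∑[ x < n ] (f x * 𝟙 (x ≟ c)) ≡ f c
∑-𝟙≟ {suc n} f zero = begin
  f zero * 1 + ∑[ x < n ] (f (suc x) * 0)   ≡⟨ cong₂ _+_ (*-identityʳ (f zero)) (sum-cong-≗ {n} (λ x → *-zeroʳ (f (suc x)))) ⟩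
  f zero + ∑[ x < n ] 0                     ≡⟨ cong (f zero +_) (sum-replicate-zero n) ⟩
  f zero + 0                                ≡⟨ +-identityʳ (f zero) ⟩
  f zero                                    ∎
  where open ≡-Reasoning
∑-𝟙≟ {suc n} f (suc c) =
  trans (cong (_+ ∑[ x < n ] (f (suc x) * 𝟙 (x ≟ c))) (*-zeroʳ (f zero))) (∑-𝟙≟ (λ x → f (suc x)) c)

Δcount≡∑ : ∀ {v} .{{_ : NonZero v}} (A B : Subset v) (g : Fin v) →
           Δcount A B g ≡ ∑[ y < v ] (𝟙 (g ⊕ y ∈? A) * 𝟙 (y ∈? B))
Δcount≡∑ {v} A B g = begin
  Δcount A B g
    ≡⟨ length-filter-cartesianProduct P? (λ x → x) (λ y → y) ⟩
  ∑[ x < v ] ∑[ y < v ] 𝟙 (P? (x , y))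
    ≡⟨ sum-cong-≗ {v} (λ x → sum-cong-≗ {v} (λ y → split x y)) ⟩
  ∑[ x < v ] ∑[ y < v ] (𝟙 (x ∈? A) * 𝟙 (y ∈? B) * 𝟙 (x ≟ g ⊕ y))
    ≡⟨ ∑-comm {v} {v} (λ x y → 𝟙 (x ∈? A) * 𝟙 (y ∈? B) * 𝟙 (x ≟ g ⊕ y)) ⟩
  ∑[ y < v ] ∑[ x < v ] (𝟙 (x ∈? A) * 𝟙 (y ∈? B) * 𝟙 (x ≟ g ⊕ y))
    ≡⟨ sum-cong-≗ {v} (λ y → ∑-𝟙≟ (λ x → 𝟙 (x ∈? A) * 𝟙 (y ∈? B)) (g ⊕ y)) ⟩
  ∑[ y < v ] (𝟙 (g ⊕ y ∈? A) * 𝟙 (y ∈? B))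
    ∎
  where
  open ≡-Reasoning
  P? = λ (p : Fin v × Fin v) → (proj₁ p ∈? A) ×-dec ((proj₂ p ∈? B) ×-dec ((proj₁ p ⊖ proj₂ p) ≟ g))
  split : ∀ x y → 𝟙 (P? (x , y)) ≡ 𝟙 (x ∈? A) * 𝟙 (y ∈? B) * 𝟙 (x ≟ g ⊕ y)
  split x y = begin
    𝟙 (P? (x , y))                                       ≡⟨ 𝟙-×-dec (x ∈? A) ((y ∈? B) ×-dec (x ⊖ y ≟ g)) ⟩
    𝟙 (x ∈? A) * 𝟙 ((y ∈? B) ×-dec (x ⊖ y ≟ g))          ≡⟨ cong (𝟙 (x ∈? A) *_) (𝟙-×-dec (y ∈? B) (x ⊖ y ≟ g)) ⟩
    𝟙 (x ∈? A) * (𝟙 (y ∈? B) * 𝟙 (x ⊖ y ≟ g))            ≡⟨ *-assoc (𝟙 (x ∈? A)) _ _ ⟨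
    𝟙 (x ∈? A) * 𝟙 (y ∈? B) * 𝟙 (x ⊖ y ≟ g)              ≡⟨ cong (𝟙 (x ∈? A) * 𝟙 (y ∈? B) *_) (𝟙-⇔ ⊖≡⇔≡⊕ (x ⊖ y ≟ g) (x ≟ g ⊕ y)) ⟩
    𝟙 (x ∈? A) * 𝟙 (y ∈? B) * 𝟙 (x ≟ g ⊕ y)              ∎

subsetOf : ∀ {v p} {P : Pred ℕ p} → Decidable P → Subset v
subsetOf P? = Vec.tabulate (λ x → does (P? (toℕ x)))

𝟙-∈-subsetOf : ∀ {v p} {P : Pred ℕ p} (P? : Decidable P) (x : Fin v) → 𝟙 (x ∈? subsetOf P?) ≡ 𝟙 (P? (toℕ x))
𝟙-∈-subsetOf P? zero with P? 0
... | yes _ = refl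
... | no _  = refl
𝟙-∈-subsetOf P? (suc x) = 𝟙-∈-subsetOf (λ n → P? (suc n)) x

∣subsetOf∣ : ∀ {v p} {P : Pred ℕ p} (P? : Decidable P) → ∣ subsetOf {v} P? ∣ ≡ ∑ℕ v (λ x → 𝟙 (P? x))
∣subsetOf∣ {v} P? = trans (∣p∣≡∑𝟙∈ (subsetOf {v} P?)) (sum-cong-≗ {v} (𝟙-∈-subsetOf P?))

Δcount-subsetOf : ∀ {v p q} .{{_ : NonZero v}} {P : Pred ℕ p} {Q : Pred ℕ q} (P? : Decidable P) (Q? : Decidable Q) →
                  Periodic v (λ x → 𝟙 (P? x)) → ∀ g →
                  Δcount (subsetOf P?) (subsetOf Q?) g ≡ correlation v (λ x → 𝟙 (P? x)) (λ x → 𝟙 (Q? x)) (toℕ g)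
Δcount-subsetOf {v} P? Q? per g = trans (Δcount≡∑ (subsetOf P?) (subsetOf Q?) g)
  (sum-cong-≗ {v} (λ y → cong₂ _*_ (member y) (𝟙-∈-subsetOf Q? y)))
  where
  member : ∀ y → 𝟙 (g ⊕ y ∈? subsetOf P?) ≡ 𝟙 (P? (toℕ g + toℕ y))
  member y = begin
    𝟙 (g ⊕ y ∈? subsetOf P?)           ≡⟨ 𝟙-∈-subsetOf P? (g ⊕ y) ⟩
    𝟙 (P? (toℕ (g ⊕ y)))               ≡⟨ cong (λ x → 𝟙 (P? x)) (toℕ-fromℕ< _) ⟩
    𝟙 (P? ((toℕ g + toℕ y) % v))       ≡⟨ periodic-% per (toℕ g + toℕ y) ⟩
    𝟙 (P? (toℕ g + toℕ y))             ∎
    where open ≡-Reasoning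

residues< : ∀ v a μ .{{_ : NonZero a}} → Subset v
residues< v a μ = subsetOf (λ x → x % a <? μ)

periodic-%< : ∀ a μ .{{_ : NonZero a}} → Periodic a (λ x → 𝟙 (x % a <? μ))
periodic-%< a μ x = cong (λ r → 𝟙 (r <? μ)) (trans (cong (_% a) (+-comm a x)) ([m+n]%n≡m%n x a))

∑ℕ-%< : ∀ t a {μ} .{{_ : NonZero a}} → μ ≤ a → ∑ℕ (t * a) (λ x → 𝟙 (x % a <? μ)) ≡ t * μ
∑ℕ-%< t a {μ} μ≤a = begin
  ∑ℕ (t * a) (λ x → 𝟙 (x % a <? μ))   ≡⟨ ∑ℕ-periodic t a (periodic-%< a μ) ⟩
  t * ∑ℕ a (λ x → 𝟙 (x % a <? μ))     ≡⟨ cong (t *_) (∑ℕ-cong a (λ x x<a → cong (λ r → 𝟙 (r <? μ)) (m<n⇒m%n≡m x<a))) ⟩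
  t * ∑ℕ a (λ x → 𝟙 (x <? μ))         ≡⟨ cong (t *_) (∑ℕ-< μ≤a) ⟩
  t * μ                               ∎
  where open ≡-Reasoning

∣residues<∣ : ∀ {v a μ k} .{{_ : NonZero a}} → a ∣ v → μ ≤ a → k * a ≡ μ * v → ∣ residues< v a μ ∣ ≡ k
∣residues<∣ {a = a} {μ} {k} (divides t refl) μ≤a k*a≡μ*v = begin
  ∣ residues< (t * a) a μ ∣             ≡⟨ ∣subsetOf∣ {t * a} (λ x → x % a <? μ) ⟩
  ∑ℕ (t * a) (λ x → 𝟙 (x % a <? μ))     ≡⟨ ∑ℕ-%< t a μ≤a ⟩
  t * μ                                 ≡⟨ *-cancelʳ-≡ (t * μ) k a (sym k*a≡t*μ*a) ⟩
  k                                     ∎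
  where
  open ≡-Reasoning
  k*a≡t*μ*a : k * a ≡ t * μ * a
  k*a≡t*μ*a = trans k*a≡μ*v (trans (sym (*-assoc μ t a)) (cong (_* a) (*-comm μ t)))

Δcount-residues< : ∀ {v a b μ ν k l} .{{_ : NonZero v}} .{{_ : NonZero a}} .{{_ : NonZero b}} →
                   a ∣ v → b ∣ v → Coprime a b → μ ≤ a → ν ≤ b → k * a ≡ μ * v → l * b ≡ ν * v →
                   ∀ g → Δcount (residues< v a μ) (residues< v b ν) g * v ≡ k * l
Δcount-residues< {v} {a} {b} {μ} {ν} {k} {l} a∣v b∣v coprime μ≤a ν≤b k*a≡μ*v l*b≡ν*v g = begin
  Δcount (residues< v a μ) (residues< v b ν) g * v
    ≡⟨ cong (_* v) (Δcount-subsetOf P? Q? (periodic-∣ (periodic-%< a μ) a∣v) g) ⟩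
  correlation v (λ x → 𝟙 (P? x)) (λ x → 𝟙 (Q? x)) (toℕ g) * v
    ≡⟨ correlation*n≡∑*∑ coprime a∣v b∣v (periodic-%< a μ) (periodic-%< b ν) (toℕ g) ⟩
  ∑ℕ v (λ x → 𝟙 (P? x)) * ∑ℕ v (λ x → 𝟙 (Q? x))
    ≡⟨ cong₂ _*_ (∣subsetOf∣ {v} P?) (∣subsetOf∣ {v} Q?) ⟨
  ∣ residues< v a μ ∣ * ∣ residues< v b ν ∣
    ≡⟨ cong₂ _*_ (∣residues<∣ {k = k} a∣v μ≤a k*a≡μ*v) (∣residues<∣ {k = l} b∣v ν≤b l*b≡ν*v) ⟩
  k * l
    ∎
  where
  open ≡-Reasoning
  P? = λ x → x % a <? μ
  Q? = λ x → x % b <? ν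

divisor-nonZero : ∀ {a v} .{{_ : NonZero v}} → a ∣ v → NonZero a
divisor-nonZero {zero}  {v} 0∣v = contradiction (0∣⇒≡0 0∣v) (≢-nonZero⁻¹ v)
divisor-nonZero {suc _}     _   = _

residues<-isGPSEDF : ∀ v m .{{_ : NonZero v}} (a : Fin m → ℕ) (a∣v : ∀ i → a i ∣ v) →
                     (∀ i j → i ≢ j → Coprime (a i) (a j)) →
                     (μ : Fin m → ℕ) → (∀ i → μ i ≤ a i) → (k : Fin m → ℕ) → (∀ i → k i * a i ≡ μ i * v) →
                     IsGPSEDF v m k (λ i → residues< v (a i) (μ i) {{divisor-nonZero (a∣v i)}})
residues<-isGPSEDF v m a a∣v coprime μ μ≤a k k*a≡μ*v =
  (λ i → ∣residues<∣ {k = k i} {{divisor-nonZero (a∣v i)}} (a∣v i) (μ≤a i) (k*a≡μ*v i)) ,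
  (λ i j i≢j → Δcount-residues< {k = k i} {k j} {{_}} {{divisor-nonZero (a∣v i)}} {{divisor-nonZero (a∣v j)}}
                 (a∣v i) (a∣v j) (coprime i j i≢j) (μ≤a i) (μ≤a j) (k*a≡μ*v i) (k*a≡μ*v j))

theorem3p10 : (v m : ℕ) .{{_ : NonZero v}} → (a : Fin m → ℕ)
    → (∀ i → a i ∣ v)
    → (∀ i j → i ≢ j → Coprime (a i) (a j))
    → (∀ (k : Fin m → ℕ) → (∀ i → k i * a i ≡ v)
         → Σ (Fin m → Subset v) (λ A → IsGPSEDF v m k A))
      × (∀ (μ : Fin m → ℕ) → (∀ i → μ i < a i)
         → ∀ (k : Fin m → ℕ) → (∀ i → k i * a i ≡ μ i * v)
         → Σ (Fin m → Subset v) (λ A → IsGPSEDF v m k A))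
theorem3p10 v m a a∣v coprime =
  (λ k k*a≡v → _ , residues<-isGPSEDF v m a a∣v coprime (λ _ → 1) 1≤a k (λ i → trans (k*a≡v i) (sym (*-identityˡ v)))) ,
  (λ μ μ<a k k*a≡μ*v → _ , residues<-isGPSEDF v m a a∣v coprime μ (λ i → <⇒≤ (μ<a i)) k k*a≡μ*v)
  where
  1≤a : ∀ i → 1 ≤ a i
  1≤a i = >-nonZero⁻¹ (a i) {{divisor-nonZero (a∣v i)}}
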